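{- Let $0<\varepsilon\le 1$ and $n\in\mathbb{N}$, and let $t=\lceil\frac{2\log n}{\varepsilon}\rceil$. Then for every graph $G$ on $n$ vertices (with positive edge weights) and every vertex $v$ of $G$, there exists a subgraph $H'_v\subseteq H_t(v)$ with $\rho(H'_v)\ge(1-\varepsilon)\rho^*(v)$.
   Context: $H_t(v)$ is the $t$-hop neighbourhood of $v$: the subgraph induced by vertices at hop-distance at most $t$ from $v$. The density of a subgraph $H$ is $\rho(H)=\frac{1}{|V(H)|}\sum_{e\in E(H)}\textsl{g}(e)$, with $\textsl{g}(e)$ the edge weight. Local density: for $B\subseteq V$ and nonempty $X\subseteq V\setminus B$, let $\hat E_B(X)$ be the set of edges with one endpoint in $X$ and the other in $X\cup B$, and $\hat\rho_B(X)=\frac{1}{|X|}\sum_{e\in\hat E_B(X)}\textsl{g}(e)$. Define $B_0=\emptyset$ and, while $B_{i-1}\ne V$, let $S_i$ be a (inclusion-wise largest) maximizer of $\hat\rho_{B_{i-1}}(X)$ over nonempty $X\subseteq V\setminus B_{i-1}$, and $B_i=B_{i-1}\cup S_i$. For $v\in S_i$, $\rho^*(v)=\hat\rho_{B_{i-1}}(S_i)$.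
   Formalization: The parameter ε and the edge weights are rational. -}

module Defs where

open import Data.Nat as ℕ using (ℕ; zero; suc)
open import Data.Integer using (+_)
open import Data.Rational using (ℚ; 0ℚ; 1ℚ; _+_; _*_; _-_; _/_; _≤_; _<_)
open import Data.Bool using (Bool; true; false; _∧_; _∨_; if_then_else_)
open import Data.Fin using (Fin; zero; suc; _<?_)
open import Data.Vec using (lookup)
open import Data.Fin.Subset using (Subset; _∈_; _∉_; _∪_; _⊆_; ∣_∣; Nonempty; ⊥)
open import Data.List using (List; []; _∷_)
open import Data.Product using (Σ; ∃; _×_; _,_)
open import Relation.Binary.PropositionalEquality using (_≡_)
open import Relation.Nullary.Decidable using (does)

sumFin : ∀ {n} → (Fin n → ℚ) → ℚ
sumFin {zero}  f = 0ℚ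
sumFin {suc n} f = f zero + sumFin (λ i → f (suc i))

-- Division of a rational by a natural number (division by 0 gives 0;
-- only ever used with a nonzero denominator below).
divN : ℚ → ℕ → ℚ
divN p zero    = 0ℚ
divN p (suc m) = p * ((+ 1) / suc m)

-- A weighted (simple, undirected) graph on the vertex set Fin n:
-- w i j is the weight of edge {i,j}; {i,j} is an edge iff w i j > 0.
-- Edge weights are thus positive; non-edges carry weight 0.
record WGraph (n : ℕ) : Set where
  field
    w     : Fin n → Fin n → ℚ
    sym   : ∀ i j → w i j ≡ w j i
    loop  : ∀ i → w i i ≡ 0ℚ
    nonneg : ∀ i j → 0ℚ ≤ w i j
open WGraph public

IsEdge : ∀ {n} → WGraph n → Fin n → Fin n → Set
IsEdge G i j = 0ℚ < w G i j

pairSum : ∀ {n} → WGraph n → (Fin n → Fin n → Bool) → ℚ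
pairSum G P = sumFin (λ i → sumFin (λ j →
  if does (i <? j) ∧ P i j then w G i j else 0ℚ))

mem : ∀ {n} → Fin n → Subset n → Bool
mem i S = lookup S i

data Within {n} (G : WGraph n) (v : Fin n) : ℕ → Fin n → Set where
  here : ∀ {t} → Within G v t v
  step : ∀ {t u u'} → Within G v t u → IsEdge G u u' → Within G v (suc t) u'

-- A subgraph: vertex set U (nonempty, so that density is defined) and
-- edge set F (pairs i<j with F i j = true), every edge of F being an
-- edge of G with both endpoints in U.
record Subgraph {n} (G : WGraph n) : Set where
  field
    U     : Subset n
    U≠∅   : Nonempty U
    F     : Fin n → Fin n → Bool
    F-ok  : ∀ i j → F i j ≡ true → (i ∈ U) × (j ∈ U) × IsEdge G i j
open Subgraph public

density : ∀ {n} {G : WGraph n} → Subgraph G → ℚ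
density {G = G} H = divN (pairSum G (F H)) ∣ U H ∣

-- H ⊆ H_t(v): all vertices of H at hop distance ≤ t from v (edges of H
-- are edges of G between such vertices, hence edges of H_t(v)).
InBall : ∀ {n} (G : WGraph n) (t : ℕ) (v : Fin n) → Subgraph G → Set
InBall G t v H = ∀ u → u ∈ U H → Within G v t u

hatρ : ∀ {n} → WGraph n → Subset n → Subset n → ℚ
hatρ G B X = divN (pairSum G (λ i j →
    (mem i X ∧ mem j (X ∪ B)) ∨ (mem j X ∧ mem i (X ∪ B)))) ∣ X ∣

Disjoint : ∀ {n} → Subset n → Subset n → Set
Disjoint X B = ∀ i → i ∈ X → i ∉ B

Adm : ∀ {n} → Subset n → Subset n → Set
Adm B X = Nonempty X × Disjoint X B

-- Decomp G B Ss: Ss = S_i, S_{i+1}, … is the local-density decomposition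
-- continuing from B = B_{i-1}: each S is an inclusion-wise largest
-- maximizer of ρ̂_B over admissible X, and the process stops when B = V.
data Decomp {n} (G : WGraph n) : Subset n → List (Subset n) → Set where
  done : ∀ {B} → (∀ i → i ∈ B) → Decomp G B []
  step : ∀ {B S Ss} →
         Adm B S →
         (∀ X → Adm B X → hatρ G B X ≤ hatρ G B S) →
         (∀ X → Adm B X → hatρ G B X ≡ hatρ G B S → X ⊆ S) →
         Decomp G (B ∪ S) Ss →
         Decomp G B (S ∷ Ss)

-- RhoStar G B Ss v r : in the decomposition Ss continuing from B, the
-- vertex v lies in some S_i and r = ρ̂_{B_{i-1}}(S_i).
data RhoStar {n} (G : WGraph n) : Subset n → List (Subset n) → Fin n → ℚ → Set where
  here  : ∀ {B S Ss v} → v ∈ S → RhoStar G B (S ∷ Ss) v (hatρ G B S)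
  there : ∀ {B S Ss v r} → RhoStar G (B ∪ S) Ss v r → RhoStar G B (S ∷ Ss) v r

expTerm : ℕ → ℚ → ℚ
expTerm zero    q = 1ℚ
expTerm (suc j) q = expTerm j q * q * ((+ 1) / suc j)

expSum : ℕ → ℚ → ℚ
expSum zero    q = expTerm zero q
expSum (suc k) q = expSum k q + expTerm (suc k) q

-- ExpGe q n  ⇔  exp(q) ≥ n   (for q ≥ 0).
ExpGe : ℚ → ℕ → Set
ExpGe q n = ∃ λ k → (+ n / 1) ≤ expSum k q

-- LogBound ε n t  ⇔  2 ln n / ε ≤ t   ⇔   n ≤ exp(ε t / 2).
LogBound : ℚ → ℕ → ℕ → Set
LogBound ε n t = ExpGe (ε * (+ t / 2)) n

-- IsCeilLog ε n t  ⇔  t = ⌈2 ln n / ε⌉  (least natural number ≥ 2 ln n / ε).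
IsCeilLog : ℚ → ℕ → ℕ → Set
IsCeilLog ε n t = LogBound ε n t × (∀ s → LogBound ε n s → t ℕ.≤ s)

{-# OPTIONS --safe #-}
module Submission where

open import Defs hiding (sym)
open import Data.Nat as ℕ using (ℕ; zero; suc; z≤n; s≤s)
import Data.Nat.Properties as ℕₚ
open import Data.Integer as ℤ using (+_)
import Data.Integer.Tactic.RingSolver as ℤ-Solver
open import Data.Rational using (ℚ; 0ℚ; 1ℚ; ½; _+_; _*_; _-_; -_; _/_; _≤_; _<_; *<*; toℚᵘ; nonNegative; positive)
open import Data.Rational.Properties hiding (_<?_; _≤?_; _≟_)
import Data.Rational.Properties as ℚ
import Data.Rational.Unnormalised as ℚᵘ
import Data.Rational.Unnormalised.Properties as ℚᵘ
open import Data.Bool using (Bool; true; false; T; not; _∧_; _∨_; _xor_; if_then_else_)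
open import Data.Bool.Properties using (T-∧; T-∨; T-≡)
open import Data.Fin using (Fin; zero; suc; _<?_)
open import Data.Fin.Properties using (_≟_; any?)
open import Data.Fin.Subset using (Subset; _∈_; _∪_; _∩_; ∁; _⊆_; ∣_∣; Nonempty; ⊥; ⁅_⁆)
open import Data.Fin.Subset.Properties
  using (nonempty?; Empty-unique; ∣⊥∣≡0; ∣p∣≤n; ∣⁅x⁆∣≡1; p⊆q⇒∣p∣≤∣q∣; x∈⁅y⁆⇒x≡y; x∈p∪q⁺; x∈p∪q⁻; p⊆p∪q; q⊆p∪q; p∩q⊆p; p∩q⊆q; ∉⊥)
open import Data.Vec using (tabulate; _∷_; [])
open import Data.Vec.Properties using ([]=⇒lookup; lookup⇒[]=; lookup-zipWith; lookup-map; lookup-replicate; lookup∘tabulate)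
open import Data.List using (List; _∷_)
open import Data.Product using (Σ; ∃; _×_; _,_; proj₁; proj₂)
open import Data.Sum as Sum using (_⊎_; inj₁; inj₂)
open import Function.Base using (_∘_)
open import Function.Bundles using (Equivalence)
open import Level using (0ℓ)
open import Relation.Binary.PropositionalEquality using (_≡_; refl; sym; trans; cong; cong₂; subst; subst₂; module ≡-Reasoning)
open import Relation.Nullary.Decidable using (Dec; yes; no; does; isYes; toSum; _×-dec_; toWitness; fromWitness; dec⇒maybe)
open import Relation.Nullary.Negation using (¬_; contradiction)
open import Tactic.RingSolver using (solve-∀)
open import Tactic.RingSolver.Core.AlmostCommutativeRing using (AlmostCommutativeRing; fromCommutativeRing)

-- Let r = ρ*(v), v ∈ S_i, and C = B_i = S_1 ∪ … ∪ S_i. Each S_j maximises the local density over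
-- V ∖ B_{j-1} and these maxima decrease with j, so C is r-expanding: every Y ⊆ C meets edges into C of
-- total weight at least r|Y|. (Split Y into Y ∩ B_{j-1}, handled inductively, and Y ∩ S_j, for which the
-- weight into B_j is at least ρ̂(S_j)|Y ∩ S_j| because S_j ∖ Y cannot beat S_j.)
-- Apply this to the layers Y_j = C ∩ H_j(v). Edges from Y_j into C stay inside Y_{j+1}, so if the
-- subgraph induced on Y_{j+1} has density below (1-ε)r, then |Y_j| < (1-ε)|Y_{j+1}|. If this happened
-- for every j < t, then 1 ≤ |Y_0| < (1-ε)^t n ≤ 1, where the last step is the choice of t:
-- n ≤ exp(εt/2) and (1-ε)^t ≤ (1-ε/2)^t ≤ exp(-εt/2). Only partial sums P_k of the exponential series
-- are available, and (1-δ) P_k(x+δ) ≤ P_k(x) stands in for exp(-δ) exp(x+δ) = exp(x).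

ℚ-ring : AlmostCommutativeRing 0ℓ 0ℓ
ℚ-ring = fromCommutativeRing +-*-commutativeRing (λ x → dec⇒maybe (0ℚ ℚ.≟ x))

p≤q⇒0≤q-p : ∀ {p q} → p ≤ q → 0ℚ ≤ q - p
p≤q⇒0≤q-p {p} {q} p≤q = subst (_≤ q - p) (+-inverseʳ p) (+-monoˡ-≤ (- p) p≤q)

0≤p*q : ∀ {p q} → 0ℚ ≤ p → 0ℚ ≤ q → 0ℚ ≤ p * q
0≤p*q {p} {q} 0≤p 0≤q = nonNegative⁻¹ _ {{nonNeg*nonNeg⇒nonNeg p {{nonNegative 0≤p}} q {{nonNegative 0≤q}}}}

*-monoˡ-≤-0≤ : ∀ {r p q} → 0ℚ ≤ r → p ≤ q → r * p ≤ r * q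
*-monoˡ-≤-0≤ {r} 0≤r = *-monoˡ-≤-nonNeg r {{nonNegative 0≤r}}

*-monoʳ-≤-0≤ : ∀ {r p q} → 0ℚ ≤ r → p ≤ q → p * r ≤ q * r
*-monoʳ-≤-0≤ {r} 0≤r = *-monoʳ-≤-nonNeg r {{nonNegative 0≤r}}

p≤p+q : ∀ {p q} → 0ℚ ≤ q → p ≤ p + q
p≤p+q {p} {q} 0≤q = subst (_≤ p + q) (+-identityʳ p) (+-monoʳ-≤ p 0≤q)

p-q≤p : ∀ {p q} → 0ℚ ≤ q → p - q ≤ p
p-q≤p {p} 0≤q = subst (p - _ ≤_) (+-identityʳ p) (+-monoʳ-≤ p (neg-antimono-≤ 0≤q))

+-cancelˡ-≤ : ∀ r {p q} → r + p ≤ r + q → p ≤ q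
+-cancelˡ-≤ r {p} {q} h = subst₂ _≤_ (cancel r p) (cancel r q) (+-monoʳ-≤ (- r) h)
  where
  cancel : ∀ r p → - r + (r + p) ≡ p
  cancel = solve-∀ ℚ-ring

+-cancelʳ-≤ : ∀ r {p q} → p + r ≤ q + r → p ≤ q
+-cancelʳ-≤ r {p} {q} h = +-cancelˡ-≤ r (subst₂ _≤_ (+-comm p r) (+-comm q r) h)

fromℕ : ℕ → ℚ
fromℕ m = + m / 1

recip : ℕ → ℚ
recip m = + 1 / suc m

0≤fromℕ : ∀ m → 0ℚ ≤ fromℕ m
0≤fromℕ m = nonNegative⁻¹ _ {{normalize-nonNeg m 1}}

0≤recip : ∀ m → 0ℚ ≤ recip m
0≤recip m = nonNegative⁻¹ _ {{normalize-nonNeg 1 (suc m)}}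

-- Identities between literals + m / d are checked on unnormalised representatives, where they are identities in ℤ.
fromℕ-suc : ∀ m → fromℕ (suc m) ≡ 1ℚ + fromℕ m
fromℕ-suc m = toℚᵘ-injective (ℚᵘ.≃-trans (toℚᵘ-fromℚᵘ (ℚᵘ.mkℚᵘ (+ suc m) 0)) (ℚᵘ.≃-sym
  (ℚᵘ.≃-trans (toℚᵘ-homo-+ 1ℚ (fromℕ m))
    (ℚᵘ.≃-trans (ℚᵘ.+-congʳ (toℚᵘ 1ℚ) (toℚᵘ-fromℚᵘ (ℚᵘ.mkℚᵘ (+ m) 0))) (ℚᵘ.*≡* (identity (+ m)))))))
  where
  identity : ∀ x → (+ 1 ℤ.* + 1 ℤ.+ x ℤ.* + 1) ℤ.* + 1 ≡ (+ 1 ℤ.+ x) ℤ.* (+ 1 ℤ.* + 1)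
  identity = ℤ-Solver.solve-∀

recip-inverseˡ : ∀ m → recip m * fromℕ (suc m) ≡ 1ℚ
recip-inverseˡ m = toℚᵘ-injective (ℚᵘ.≃-trans (toℚᵘ-homo-* (recip m) (fromℕ (suc m)))
  (ℚᵘ.≃-trans (ℚᵘ.*-cong (toℚᵘ-fromℚᵘ (ℚᵘ.mkℚᵘ (+ 1) m)) (toℚᵘ-fromℚᵘ (ℚᵘ.mkℚᵘ (+ suc m) 0)))
    (ℚᵘ.*≡* (identity (+ m)))))
  where
  identity : ∀ x → (+ 1 ℤ.* (+ 1 ℤ.+ x)) ℤ.* + 1 ≡ + 1 ℤ.* ((+ 1 ℤ.+ x) ℤ.* + 1)
  identity = ℤ-Solver.solve-∀

/2≡*½ : ∀ m → + m / 2 ≡ fromℕ m * ½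
/2≡*½ m = toℚᵘ-injective (ℚᵘ.≃-trans (toℚᵘ-fromℚᵘ (ℚᵘ.mkℚᵘ (+ m) 1)) (ℚᵘ.≃-sym
  (ℚᵘ.≃-trans (toℚᵘ-homo-* (fromℕ m) ½)
    (ℚᵘ.≃-trans (ℚᵘ.*-congʳ (toℚᵘ-fromℚᵘ (ℚᵘ.mkℚᵘ (+ m) 0))) (ℚᵘ.*≡* (identity (+ m)))))))
  where
  identity : ∀ x → (x ℤ.* + 1) ℤ.* (+ 1 ℤ.* + 2) ≡ x ℤ.* + 2
  identity = ℤ-Solver.solve-∀

fromℕ-mono-≤ : ∀ {m n} → m ℕ.≤ n → fromℕ m ≤ fromℕ n
fromℕ-mono-≤ {n = n} z≤n = 0≤fromℕ n
fromℕ-mono-≤ {suc m} {suc n} (s≤s m≤n) =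
  subst₂ _≤_ (sym (fromℕ-suc m)) (sym (fromℕ-suc n)) (+-monoʳ-≤ 1ℚ (fromℕ-mono-≤ m≤n))

0<1 : 0ℚ < 1ℚ
0<1 = *<* (ℤ.+<+ (s≤s z≤n))

fromℕ-cancel-≤ : ∀ {m n} → fromℕ m ≤ fromℕ n → m ℕ.≤ n
fromℕ-cancel-≤ {m} {n} m≤n = ℕₚ.≮⇒≥ λ n<m → <-irrefl refl (<-≤-trans (n<1+n n) (≤-trans (fromℕ-mono-≤ n<m) m≤n))
  where
  n<1+n : ∀ n → fromℕ n < fromℕ (suc n)
  n<1+n n = subst₂ _<_ (+-identityˡ (fromℕ n)) (sym (fromℕ-suc n)) (+-monoˡ-< (fromℕ n) 0<1)

infixr 8 _^_

_^_ : ℚ → ℕ → ℚ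
p ^ zero  = 1ℚ
p ^ suc s = p * p ^ s

0≤^ : ∀ {p} s → 0ℚ ≤ p → 0ℚ ≤ p ^ s
0≤^ zero    0≤p = ≤ᵇ⇒≤ _
0≤^ (suc s) 0≤p = 0≤p*q 0≤p (0≤^ s 0≤p)

^-mono-≤ : ∀ {p q} s → 0ℚ ≤ p → p ≤ q → p ^ s ≤ q ^ s
^-mono-≤ zero    0≤p p≤q = ≤-refl
^-mono-≤ (suc s) 0≤p p≤q =
  ≤-trans (*-monoʳ-≤-0≤ (0≤^ s 0≤p) p≤q) (*-monoˡ-≤-0≤ (≤-trans 0≤p p≤q) (^-mono-≤ s 0≤p p≤q))

-- Partial sums of the exponential series

0≤expTerm : ∀ j {x} → 0ℚ ≤ x → 0ℚ ≤ expTerm j x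
0≤expTerm zero    0≤x = ≤ᵇ⇒≤ _
0≤expTerm (suc j) 0≤x = 0≤p*q (0≤p*q (0≤expTerm j 0≤x) 0≤x) (0≤recip j)

0≤expSum : ∀ k {x} → 0ℚ ≤ x → 0ℚ ≤ expSum k x
0≤expSum zero    0≤x = ≤ᵇ⇒≤ _
0≤expSum (suc k) 0≤x = +-mono-≤ (0≤expSum k 0≤x) (0≤expTerm (suc k) 0≤x)

expTerm-mono-≤ : ∀ j {a b} → 0ℚ ≤ a → a ≤ b → expTerm j a ≤ expTerm j b
expTerm-mono-≤ zero    0≤a a≤b = ≤-refl
expTerm-mono-≤ (suc j) 0≤a a≤b = *-monoʳ-≤-0≤ (0≤recip j) (≤-trans
  (*-monoʳ-≤-0≤ 0≤a (expTerm-mono-≤ j 0≤a a≤b))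
  (*-monoˡ-≤-0≤ (0≤expTerm j (≤-trans 0≤a a≤b)) a≤b))

expTerm-*-arg : ∀ j x → expTerm j x * x ≡ expTerm (suc j) x * fromℕ (suc j)
expTerm-*-arg j x = begin
  expTerm j x * x                              ≡⟨ sym (*-identityʳ _) ⟩
  expTerm j x * x * 1ℚ                         ≡⟨ cong (expTerm j x * x *_) (sym (recip-inverseˡ j)) ⟩
  expTerm j x * x * (recip j * fromℕ (suc j))  ≡⟨ sym (*-assoc (expTerm j x * x) (recip j) (fromℕ (suc j))) ⟩
  expTerm (suc j) x * fromℕ (suc j)            ∎
  where open ≡-Reasoning

expTerm-increment : ∀ j {b δ} → 0ℚ ≤ b → 0ℚ ≤ δ →
                    expTerm (suc j) (b + δ) ≤ expTerm (suc j) b + δ * expTerm j (b + δ)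
expTerm-increment zero {b} {δ} _ _ = ≤-reflexive (identity b δ)
  where
  identity : ∀ b δ → 1ℚ * (b + δ) * 1ℚ ≡ 1ℚ * b * 1ℚ + δ * 1ℚ
  identity = solve-∀ ℚ-ring
expTerm-increment (suc j) {b} {δ} 0≤b 0≤δ = begin
  A * (b + δ) * c                                  ≤⟨ *-monoʳ-≤-0≤ (0≤recip (suc j)) A*x≤ ⟩
  (B * b + δ * A * fromℕ (suc (suc j))) * c        ≡⟨ collect B b δ A (fromℕ (suc (suc j))) c ⟩
  B * b * c + δ * A * (c * fromℕ (suc (suc j)))    ≡⟨ cong (λ m → B * b * c + δ * A * m) (recip-inverseˡ (suc j)) ⟩
  B * b * c + δ * A * 1ℚ                           ≡⟨ cong (_+_ (B * b * c)) (*-identityʳ _) ⟩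
  B * b * c + δ * A                                ∎
  where
  open ≤-Reasoning
  x = b + δ
  A = expTerm (suc j) x
  B = expTerm (suc j) b
  E = expTerm j x
  c = recip (suc j)
  collect : ∀ B b δ A n c → (B * b + δ * A * n) * c ≡ B * b * c + δ * A * (c * n)
  collect = solve-∀ ℚ-ring
  expand : ∀ B b δ E A → (B + δ * E) * b + A * δ ≡ B * b + δ * (E * b) + A * δ
  expand = solve-∀ ℚ-ring
  regroup : ∀ B b δ A n → B * b + δ * (A * n) + A * δ ≡ B * b + δ * A * (1ℚ + n)
  regroup = solve-∀ ℚ-ring
  A*x≤ : A * x ≤ B * b + δ * A * fromℕ (suc (suc j))
  A*x≤ = begin
    A * x                                    ≡⟨ *-distribˡ-+ A b δ ⟩
    A * b + A * δ                            ≤⟨ +-monoˡ-≤ (A * δ) (*-monoʳ-≤-0≤ 0≤b (expTerm-increment j 0≤b 0≤δ)) ⟩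
    (B + δ * E) * b + A * δ                  ≡⟨ expand B b δ E A ⟩
    B * b + δ * (E * b) + A * δ              ≤⟨ +-monoˡ-≤ (A * δ) (+-monoʳ-≤ (B * b)
                                                  (*-monoˡ-≤-0≤ 0≤δ (*-monoˡ-≤-0≤ (0≤expTerm j (+-mono-≤ 0≤b 0≤δ)) (p≤p+q 0≤δ)))) ⟩
    B * b + δ * (E * x) + A * δ              ≡⟨ cong (λ m → B * b + δ * m + A * δ) (expTerm-*-arg j x) ⟩
    B * b + δ * (A * fromℕ (suc j)) + A * δ  ≡⟨ regroup B b δ A (fromℕ (suc j)) ⟩
    B * b + δ * A * (1ℚ + fromℕ (suc j))     ≡⟨ cong (λ m → B * b + δ * A * m) (sym (fromℕ-suc (suc j))) ⟩
    B * b + δ * A * fromℕ (suc (suc j))      ∎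

expSum-increment : ∀ k {b δ} → 0ℚ ≤ b → 0ℚ ≤ δ →
                   expSum (suc k) (b + δ) ≤ expSum (suc k) b + δ * expSum k (b + δ)
expSum-increment zero {b} {δ} 0≤b 0≤δ = begin
  1ℚ + expTerm 1 (b + δ)                    ≤⟨ +-monoʳ-≤ 1ℚ (expTerm-increment 0 0≤b 0≤δ) ⟩
  1ℚ + (expTerm 1 b + δ * 1ℚ)               ≡⟨ sym (+-assoc 1ℚ (expTerm 1 b) (δ * 1ℚ)) ⟩
  1ℚ + expTerm 1 b + δ * 1ℚ                 ∎
  where open ≤-Reasoning
expSum-increment (suc k) {b} {δ} 0≤b 0≤δ = begin
  expSum (suc k) x + expTerm (suc (suc k)) x
    ≤⟨ +-mono-≤ (expSum-increment k 0≤b 0≤δ) (expTerm-increment (suc k) 0≤b 0≤δ) ⟩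
  (expSum (suc k) b + δ * expSum k x) + (expTerm (suc (suc k)) b + δ * expTerm (suc k) x)
    ≡⟨ regroup (expSum (suc k) b) (expSum k x) (expTerm (suc (suc k)) b) (expTerm (suc k) x) δ ⟩
  expSum (suc k) b + expTerm (suc (suc k)) b + δ * (expSum k x + expTerm (suc k) x)
    ∎
  where
  open ≤-Reasoning
  x = b + δ
  regroup : ∀ P p E e δ → (P + δ * p) + (E + δ * e) ≡ P + E + δ * (p + e)
  regroup = solve-∀ ℚ-ring

expSum-shift : ∀ k {b δ} → 0ℚ ≤ b → 0ℚ ≤ δ → (1ℚ - δ) * expSum k (b + δ) ≤ expSum k b
expSum-shift zero {b} {δ} _ 0≤δ = subst (_≤ 1ℚ) (sym (*-identityʳ (1ℚ - δ))) (p-q≤p 0≤δ)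
expSum-shift (suc k) {b} {δ} 0≤b 0≤δ = begin
  (1ℚ - δ) * P                ≡⟨ distrib δ P ⟩
  P - δ * P                   ≤⟨ +-monoˡ-≤ (- (δ * P)) (expSum-increment k 0≤b 0≤δ) ⟩
  expSum (suc k) b + δ * expSum k x - δ * P
    ≤⟨ +-monoˡ-≤ (- (δ * P)) (+-monoʳ-≤ (expSum (suc k) b)
         (*-monoˡ-≤-0≤ 0≤δ (p≤p+q (0≤expTerm (suc k) (+-mono-≤ 0≤b 0≤δ))))) ⟩
  expSum (suc k) b + δ * P - δ * P  ≡⟨ cancel (expSum (suc k) b) (δ * P) ⟩
  expSum (suc k) b            ∎
  where
  open ≤-Reasoning
  x = b + δ
  P = expSum (suc k) x
  distrib : ∀ δ P → (1ℚ - δ) * P ≡ P - δ * P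
  distrib = solve-∀ ℚ-ring
  cancel : ∀ p q → p + q - q ≡ p
  cancel = solve-∀ ℚ-ring

expSum-0≤1 : ∀ k → expSum k 0ℚ ≤ 1ℚ
expSum-0≤1 zero    = ≤-refl
expSum-0≤1 (suc k) = subst (_≤ 1ℚ) (sym vanishing) (expSum-0≤1 k)
  where
  vanishing : expSum k 0ℚ + expTerm (suc k) 0ℚ ≡ expSum k 0ℚ
  vanishing = begin
    expSum k 0ℚ + expTerm k 0ℚ * 0ℚ * recip k  ≡⟨ cong (λ e → expSum k 0ℚ + e * recip k) (*-zeroʳ (expTerm k 0ℚ)) ⟩
    expSum k 0ℚ + 0ℚ * recip k                 ≡⟨ cong (_+_ (expSum k 0ℚ)) (*-zeroˡ (recip k)) ⟩
    expSum k 0ℚ + 0ℚ                           ≡⟨ +-identityʳ _ ⟩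
    expSum k 0ℚ                                ∎
    where open ≡-Reasoning

[1-δ]^s*expSum[sδ]≤1 : ∀ {δ} → 0ℚ ≤ δ → δ ≤ 1ℚ → ∀ k s → (1ℚ - δ) ^ s * expSum k (fromℕ s * δ) ≤ 1ℚ
[1-δ]^s*expSum[sδ]≤1 {δ} 0≤δ δ≤1 k zero =
  subst (_≤ 1ℚ) (sym (trans (*-identityˡ _) (cong (expSum k) (*-zeroˡ δ)))) (expSum-0≤1 k)
[1-δ]^s*expSum[sδ]≤1 {δ} 0≤δ δ≤1 k (suc s) = begin
  (1ℚ - δ) * (1ℚ - δ) ^ s * expSum k (fromℕ (suc s) * δ)  ≡⟨ cong (λ y → (1ℚ - δ) * (1ℚ - δ) ^ s * expSum k y) sucδ ⟩
  (1ℚ - δ) * (1ℚ - δ) ^ s * expSum k (sδ + δ)             ≡⟨ swap (1ℚ - δ) ((1ℚ - δ) ^ s) (expSum k (sδ + δ)) ⟩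
  (1ℚ - δ) ^ s * ((1ℚ - δ) * expSum k (sδ + δ))           ≤⟨ *-monoˡ-≤-0≤ (0≤^ s (p≤q⇒0≤q-p δ≤1))
                                                                (expSum-shift k (0≤p*q (0≤fromℕ s) 0≤δ) 0≤δ) ⟩
  (1ℚ - δ) ^ s * expSum k sδ                              ≤⟨ [1-δ]^s*expSum[sδ]≤1 0≤δ δ≤1 k s ⟩
  1ℚ                                                      ∎
  where
  open ≤-Reasoning
  sδ = fromℕ s * δ
  swap : ∀ a b c → a * b * c ≡ b * (a * c)
  swap = solve-∀ ℚ-ring
  sucδ : fromℕ (suc s) * δ ≡ sδ + δ
  sucδ = trans (cong (_* δ) (fromℕ-suc s)) (trans (*-distribʳ-+ δ 1ℚ (fromℕ s))
           (trans (cong (_+ sδ) (*-identityˡ δ)) (+-comm δ sδ)))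

logBound⇒[1-ε]^t*n≤1 : ∀ {ε n t} → 0ℚ ≤ ε → ε ≤ 1ℚ → LogBound ε n t → (1ℚ - ε) ^ t * fromℕ n ≤ 1ℚ
logBound⇒[1-ε]^t*n≤1 {ε} {n} {t} 0≤ε ε≤1 (k , n≤expSum) = begin
  (1ℚ - ε) ^ t * fromℕ n                       ≤⟨ *-monoˡ-≤-0≤ (0≤^ t 0≤1-ε) n≤expSum ⟩
  (1ℚ - ε) ^ t * expSum k (ε * (+ t / 2))      ≡⟨ cong (λ y → (1ℚ - ε) ^ t * expSum k y) εt/2≡ ⟩
  (1ℚ - ε) ^ t * expSum k (fromℕ t * ε/2)      ≤⟨ *-monoʳ-≤-0≤ (0≤expSum k (0≤p*q (0≤fromℕ t) 0≤ε/2))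
                                                    (^-mono-≤ t 0≤1-ε 1-ε≤1-ε/2) ⟩
  (1ℚ - ε/2) ^ t * expSum k (fromℕ t * ε/2)    ≤⟨ [1-δ]^s*expSum[sδ]≤1 0≤ε/2 ε/2≤1 k t ⟩
  1ℚ                                           ∎
  where
  open ≤-Reasoning
  ε/2 = ε * ½
  0≤ε/2 : 0ℚ ≤ ε/2
  0≤ε/2 = 0≤p*q 0≤ε (≤ᵇ⇒≤ _)
  ε/2≤ε : ε/2 ≤ ε
  ε/2≤ε = subst (ε/2 ≤_) (*-identityʳ ε) (*-monoˡ-≤-0≤ 0≤ε (≤ᵇ⇒≤ _))
  ε/2≤1 : ε/2 ≤ 1ℚ
  ε/2≤1 = ≤-trans ε/2≤ε ε≤1
  0≤1-ε : 0ℚ ≤ 1ℚ - ε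
  0≤1-ε = p≤q⇒0≤q-p ε≤1
  1-ε≤1-ε/2 : 1ℚ - ε ≤ 1ℚ - ε/2
  1-ε≤1-ε/2 = +-monoʳ-≤ 1ℚ (neg-antimono-≤ ε/2≤ε)
  εt/2≡ : ε * (+ t / 2) ≡ fromℕ t * ε/2
  εt/2≡ = trans (cong (ε *_) (/2≡*½ t)) (swap ε (fromℕ t) ½)
    where
    swap : ∀ a b c → a * (b * c) ≡ b * (a * c)
    swap = solve-∀ ℚ-ring

∧-intro : ∀ {a b} → T a → T b → T (a ∧ b)
∧-intro ta tb = Equivalence.from T-∧ (ta , tb)

∧-elim : ∀ {a b} → T (a ∧ b) → T a × T b
∧-elim = Equivalence.to T-∧

-- After rewriting membership in ∪, ∩ and ∁, every pointwise fact about subsets used below is a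
-- Boolean tautology in the membership bits, which truthTable-sound checks on all assignments.
BoolFun : ℕ → Set
BoolFun zero    = Bool
BoolFun (suc k) = Bool → BoolFun k

Valid : ∀ k → BoolFun k → Set
Valid zero    b = T b
Valid (suc k) f = ∀ b → Valid k (f b)

truthTable : ∀ k → BoolFun k → Bool
truthTable zero    b = b
truthTable (suc k) f = truthTable k (f true) ∧ truthTable k (f false)

truthTable-sound : ∀ k f → T (truthTable k f) → Valid k f
truthTable-sound zero    b h = h
truthTable-sound (suc k) f h true  = truthTable-sound k (f true)  (proj₁ (∧-elim h))
truthTable-sound (suc k) f h false = truthTable-sound k (f false) (proj₂ (∧-elim h))

infixr 4 _⇒ᵇ_

_⇒ᵇ_ : Bool → Bool → Bool
a ⇒ᵇ b = not a ∨ b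

⇒ᵇ-elim : ∀ {a b} → T (a ⇒ᵇ b) → T a → T b
⇒ᵇ-elim {true} h _ = h

partitions : Bool → Bool → Bool → Bool
partitions p q r = not (p ∧ q) ∧ not (r xor (p ∨ q))

packs : Bool → Bool → Bool → Bool
packs p q r = not (p ∧ q) ∧ (p ∨ q ⇒ᵇ r)

when : Bool → ℚ → ℚ
when b x = if b then x else 0ℚ

0≤when : ∀ b {x} → 0ℚ ≤ x → 0ℚ ≤ when b x
0≤when true  0≤x = 0≤x
0≤when false _   = ≤-refl

when-partitions : ∀ c p q r x → T (partitions p q r) → when (c ∧ r) x ≡ when (c ∧ p) x + when (c ∧ q) x
when-partitions false p     q     r     x _ = refl
when-partitions true  false false false x _ = refl
when-partitions true  false true  true  x _ = sym (+-identityˡ x)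
when-partitions true  true  false true  x _ = sym (+-identityʳ x)

when-packs : ∀ c p q r {x} → 0ℚ ≤ x → T (packs p q r) → when (c ∧ p) x + when (c ∧ q) x ≤ when (c ∧ r) x
when-packs false p     q     r     _   _ = ≤-refl
when-packs true  false false r     0≤x _ = 0≤when r 0≤x
when-packs true  false true  true  {x} _ _ = ≤-reflexive (+-identityˡ x)
when-packs true  true  false true  {x} _ _ = ≤-reflexive (+-identityʳ x)

sumFin-mono-≤ : ∀ {m} {f g : Fin m → ℚ} → (∀ i → f i ≤ g i) → sumFin f ≤ sumFin g
sumFin-mono-≤ {zero}  _   = ≤-refl
sumFin-mono-≤ {suc m} f≤g = +-mono-≤ (f≤g zero) (sumFin-mono-≤ (λ i → f≤g (suc i)))

0≤sumFin : ∀ {m} {f : Fin m → ℚ} → (∀ i → 0ℚ ≤ f i) → 0ℚ ≤ sumFin f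
0≤sumFin {zero}  _   = ≤-refl
0≤sumFin {suc m} 0≤f = +-mono-≤ (0≤f zero) (0≤sumFin (λ i → 0≤f (suc i)))

sumFin-≡0 : ∀ {m} {f : Fin m → ℚ} → (∀ i → f i ≡ 0ℚ) → sumFin f ≡ 0ℚ
sumFin-≡0 {zero}  _    = refl
sumFin-≡0 {suc m} f≡0 = cong₂ _+_ (f≡0 zero) (sumFin-≡0 (λ i → f≡0 (suc i)))

sumFin-+ : ∀ {m} {f g h : Fin m → ℚ} → (∀ i → h i ≡ f i + g i) → sumFin h ≡ sumFin f + sumFin g
sumFin-+ {zero}          _ = refl
sumFin-+ {suc m} {f} {g} h≡f+g = trans (cong₂ _+_ (h≡f+g zero) (sumFin-+ (λ i → h≡f+g (suc i))))
  (interchange (f zero) (g zero) (sumFin (λ i → f (suc i))) (sumFin (λ i → g (suc i))))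
  where
  interchange : ∀ a b c d → (a + b) + (c + d) ≡ (a + c) + (b + d)
  interchange = solve-∀ ℚ-ring

sumFin-+-≤ : ∀ {m} {f g h : Fin m → ℚ} → (∀ i → f i + g i ≤ h i) → sumFin f + sumFin g ≤ sumFin h
sumFin-+-≤ {f = f} {g} f+g≤h =
  subst (_≤ _) (sumFin-+ {f = f} {g} (λ _ → refl)) (sumFin-mono-≤ f+g≤h)

module _ {n} (G : WGraph n) where

  pairSum-partitions : ∀ {P Q R} → (∀ i j → T (partitions (P i j) (Q i j) (R i j))) →
                       pairSum G R ≡ pairSum G P + pairSum G Q
  pairSum-partitions {P} {Q} {R} h = sumFin-+ λ i → sumFin-+ λ j →
    when-partitions (does (i <? j)) (P i j) (Q i j) (R i j) (w G i j) (h i j)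

  pairSum-packs : ∀ {P Q R} → (∀ i j → T (packs (P i j) (Q i j) (R i j))) →
                  pairSum G P + pairSum G Q ≤ pairSum G R
  pairSum-packs {P} {Q} {R} h = sumFin-+-≤ λ i → sumFin-+-≤ λ j →
    when-packs (does (i <? j)) (P i j) (Q i j) (R i j) (nonneg G i j) (h i j)

  0≤pairSum : ∀ P → 0ℚ ≤ pairSum G P
  0≤pairSum P = 0≤sumFin λ i → 0≤sumFin λ j → 0≤when (does (i <? j) ∧ P i j) (nonneg G i j)

  pairSum-≡0 : ∀ {P} → (∀ i j → T (not (P i j))) → pairSum G P ≡ 0ℚ
  pairSum-≡0 {P} h = sumFin-≡0 λ i → sumFin-≡0 λ j → vanish (does (i <? j)) (P i j) (h i j)
    where
    vanish : ∀ c p {x} → T (not p) → when (c ∧ p) x ≡ 0ℚ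
    vanish false p     _ = refl
    vanish true  false _ = refl

  pairSum-mono-edges : ∀ {P Q} → (∀ i j → T (P i j) → IsEdge G i j → T (Q i j)) → pairSum G P ≤ pairSum G Q
  pairSum-mono-edges {P} {Q} h = sumFin-mono-≤ λ i → sumFin-mono-≤ λ j →
    mono (does (i <? j)) (P i j) (Q i j) (nonneg G i j) (h i j)
    where
    mono : ∀ c p q {x} → 0ℚ ≤ x → (T p → 0ℚ < x → T q) → when (c ∧ p) x ≤ when (c ∧ q) x
    mono false p     q     _   _ = ≤-refl
    mono true  false q     0≤x _ = 0≤when q 0≤x
    mono true  true  true  _   _ = ≤-refl
    mono true  true  false 0≤x h = ≮⇒≥ (h _)

pairSum-trivial : ∀ {n} (G : WGraph n) P → n ℕ.≤ 1 → pairSum G P ≡ 0ℚ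
pairSum-trivial {zero}        G P _ = refl
pairSum-trivial {suc zero}    G P _ = refl
pairSum-trivial {suc (suc n)} G P (s≤s ())

∈⇒T : ∀ {n} {i : Fin n} {X} → i ∈ X → T (mem i X)
∈⇒T i∈X = subst T (sym ([]=⇒lookup i∈X)) _

T⇒∈ : ∀ {n} {i : Fin n} {X} → T (mem i X) → i ∈ X
T⇒∈ {i = i} {X} h = lookup⇒[]= i X (Equivalence.to T-≡ h)

mem-∪ : ∀ {n} (i : Fin n) X Y → mem i (X ∪ Y) ≡ mem i X ∨ mem i Y
mem-∪ i = lookup-zipWith _∨_ i

mem-∩ : ∀ {n} (i : Fin n) X Y → mem i (X ∩ Y) ≡ mem i X ∧ mem i Y
mem-∩ i = lookup-zipWith _∧_ i

mem-∁ : ∀ {n} (i : Fin n) X → mem i (∁ X) ≡ not (mem i X)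
mem-∁ i X = lookup-map i not X

mem-⊥ : ∀ {n} (i : Fin n) → mem i ⊥ ≡ false
mem-⊥ i = lookup-replicate i false

size : ∀ {n} → Subset n → ℚ
size X = fromℕ ∣ X ∣

size≡sumFin : ∀ {n} (X : Subset n) → size X ≡ sumFin (λ i → when (mem i X) 1ℚ)
size≡sumFin []          = refl
size≡sumFin (true ∷ X)  = trans (fromℕ-suc ∣ X ∣) (cong (_+_ 1ℚ) (size≡sumFin X))
size≡sumFin (false ∷ X) = trans (size≡sumFin X) (sym (+-identityˡ _))

size-partitions : ∀ {n} (P Q R : Subset n) → (∀ i → T (partitions (mem i P) (mem i Q) (mem i R))) →
                  size R ≡ size P + size Q
size-partitions P Q R h = begin
  size R                          ≡⟨ size≡sumFin R ⟩
  sumFin (λ i → when (mem i R) 1ℚ) ≡⟨ sumFin-+ (λ i → when-partitions true (mem i P) (mem i Q) (mem i R) 1ℚ (h i)) ⟩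
  sumFin (λ i → when (mem i P) 1ℚ) + sumFin (λ i → when (mem i Q) 1ℚ)
                                  ≡⟨ sym (cong₂ _+_ (size≡sumFin P) (size≡sumFin Q)) ⟩
  size P + size Q                 ∎
  where open ≡-Reasoning

size-⊥ : ∀ {n} → size (⊥ {n}) ≡ 0ℚ
size-⊥ {n} = cong fromℕ (∣⊥∣≡0 n)

size≤n : ∀ {n} (X : Subset n) → size X ≤ fromℕ n
size≤n X = fromℕ-mono-≤ (∣p∣≤n X)

1≤size : ∀ {n} {X : Subset n} → Nonempty X → 1ℚ ≤ size X
1≤size {X = X} (x , x∈X) = subst (λ m → fromℕ m ≤ size X) (∣⁅x⁆∣≡1 x) (fromℕ-mono-≤ (p⊆q⇒∣p∣≤∣q∣ ⁅x⁆⊆X))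
  where
  ⁅x⁆⊆X : ⁅ x ⁆ ⊆ X
  ⁅x⁆⊆X y∈⁅x⁆ = subst (_∈ X) (sym (x∈⁅y⁆⇒x≡y x y∈⁅x⁆)) x∈X

0<size : ∀ {n} {X : Subset n} → Nonempty X → 0ℚ < size X
0<size ne = <-≤-trans 0<1 (1≤size ne)

divN-*-cancel : ∀ p m → 0ℚ < fromℕ m → divN p m * fromℕ m ≡ p
divN-*-cancel p zero    0<0 = contradiction 0<0 (<-irrefl refl)
divN-*-cancel p (suc m) _   = trans (*-assoc p (recip m) (fromℕ (suc m)))
  (trans (cong (p *_) (recip-inverseˡ m)) (*-identityʳ p))

0≤divN : ∀ {p} → 0ℚ ≤ p → ∀ m → 0ℚ ≤ divN p m
0≤divN 0≤p zero    = ≤-refl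
0≤divN 0≤p (suc m) = 0≤p*q 0≤p (0≤recip m)

module _ {n} {X : Subset n} (ne : Nonempty X) where

  divN-size : ∀ p → divN p ∣ X ∣ * size X ≡ p
  divN-size p = divN-*-cancel p ∣ X ∣ (0<size ne)

  divN≤⇒≤*size : ∀ {p r} → divN p ∣ X ∣ ≤ r → p ≤ r * size X
  divN≤⇒≤*size {p} h = subst (_≤ _) (divN-size p) (*-monoʳ-≤-0≤ (<⇒≤ (0<size ne)) h)

  ≤*size⇒divN≤ : ∀ {p r} → p ≤ r * size X → divN p ∣ X ∣ ≤ r
  ≤*size⇒divN≤ {p} h = *-cancelʳ-≤-pos (size X) {{positive (0<size ne)}} (subst (_≤ _) (sym (divN-size p)) h)

  *size≤⇒≤divN : ∀ {p r} → r * size X ≤ p → r ≤ divN p ∣ X ∣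
  *size≤⇒≤divN {p} h = *-cancelʳ-≤-pos (size X) {{positive (0<size ne)}} (subst (_ ≤_) (sym (divN-size p)) h)

disjoint⇒ᵇ : ∀ {n} {X Y : Subset n} → Disjoint X Y → ∀ i → T (not (mem i X ∧ mem i Y))
disjoint⇒ᵇ {X = X} {Y} X#Y i with mem i X in eqX | mem i Y in eqY
... | true  | true  = X#Y i (lookup⇒[]= i X eqX) (lookup⇒[]= i Y eqY)
... | true  | false = _
... | false | _     = _

⊆⇒ᵇ : ∀ {n} {X Y : Subset n} → X ⊆ Y → ∀ i → T (mem i X ⇒ᵇ mem i Y)
⊆⇒ᵇ {X = X} X⊆Y i with mem i X in eqX
... | true  = ∈⇒T (X⊆Y (lookup⇒[]= i X eqX))
... | false = _

Disjoint-sym : ∀ {n} {X Y : Subset n} → Disjoint X Y → Disjoint Y X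
Disjoint-sym X#Y i i∈Y i∈X = X#Y i i∈X i∈Y

Disjoint-∪⁻ : ∀ {n} {X Y Z : Subset n} → Disjoint X (Y ∪ Z) → Disjoint X Y × Disjoint X Z
Disjoint-∪⁻ {Z = Z} X#YZ = (λ i i∈X i∈Y → X#YZ i i∈X (p⊆p∪q Z i∈Y))
                         , (λ i i∈X i∈Z → X#YZ i i∈X (q⊆p∪q _ Z i∈Z))

-- Local density

incidentᵇ : Bool → Bool → Bool → Bool → Bool
incidentᵇ xi xj di dj = (xi ∧ dj) ∨ (xj ∧ di)

module LocalDensity {n} (G : WGraph n) where

  incident : Subset n → Subset n → Fin n → Fin n → Bool
  incident X D i j = incidentᵇ (mem i X) (mem j X) (mem i D) (mem j D)

  -- The weight of the edges with one endpoint in X and the other in D; hatρ G B X unfolds to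
  -- divN (edgeWeight X (X ∪ B)) ∣ X ∣.
  edgeWeight : Subset n → Subset n → ℚ
  edgeWeight X D = pairSum G (incident X D)

  Maximal : Subset n → Subset n → Set
  Maximal B S = ∀ X → Adm B X → hatρ G B X ≤ hatρ G B S

  Expanding : ℚ → Subset n → Set
  Expanding ρ C = ∀ Y → Y ⊆ C → ρ * size Y ≤ edgeWeight Y C

  edgeWeight-⊥ : ∀ D → edgeWeight ⊥ D ≡ 0ℚ
  edgeWeight-⊥ D = pairSum-≡0 G none
    where
    none : ∀ i j → T (not (incident ⊥ D i j))
    none i j rewrite mem-⊥ i | mem-⊥ j = _

  size-∪ : ∀ {X Y : Subset n} → Disjoint X Y → size (X ∪ Y) ≡ size X + size Y
  size-∪ {X} {Y} X#Y = size-partitions X Y (X ∪ Y) pointwise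
    where
    tautology : BoolFun 2
    tautology x y = not (x ∧ y) ⇒ᵇ partitions x y (x ∨ y)
    pointwise : ∀ i → T (partitions (mem i X) (mem i Y) (mem i (X ∪ Y)))
    pointwise i rewrite mem-∪ i X Y =
      ⇒ᵇ-elim (truthTable-sound 2 tautology _ (mem i X) (mem i Y)) (disjoint⇒ᵇ X#Y i)

  edgeWeight-∪ : ∀ {B S X : Subset n} → Disjoint S B → Disjoint X (B ∪ S) →
                 edgeWeight (S ∪ X) ((S ∪ X) ∪ B) ≡ edgeWeight S (S ∪ B) + edgeWeight X (X ∪ (B ∪ S))
  edgeWeight-∪ {B} {S} {X} S#B X#BS = pairSum-partitions G pointwise
    where
    hyp : ∀ i → T (not (mem i S ∧ mem i B) ∧ not (mem i X ∧ mem i B) ∧ not (mem i X ∧ mem i S))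
    hyp i = ∧-intro (disjoint⇒ᵇ S#B i)
              (∧-intro (disjoint⇒ᵇ (proj₁ (Disjoint-∪⁻ X#BS)) i) (disjoint⇒ᵇ (proj₂ (Disjoint-∪⁻ X#BS)) i))
    tautology : BoolFun 6
    tautology s s′ x x′ b b′ = disjoint₃ s x b ⇒ᵇ disjoint₃ s′ x′ b′ ⇒ᵇ
      partitions (incidentᵇ s s′ (s ∨ b) (s′ ∨ b′))
                 (incidentᵇ x x′ (x ∨ (b ∨ s)) (x′ ∨ (b′ ∨ s′)))
                 (incidentᵇ (s ∨ x) (s′ ∨ x′) ((s ∨ x) ∨ b) ((s′ ∨ x′) ∨ b′))
      where
      disjoint₃ : Bool → Bool → Bool → Bool
      disjoint₃ s x b = not (s ∧ b) ∧ not (x ∧ b) ∧ not (x ∧ s)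
    pointwise : ∀ i j → T (partitions (incident S (S ∪ B) i j) (incident X (X ∪ (B ∪ S)) i j)
                                      (incident (S ∪ X) ((S ∪ X) ∪ B) i j))
    pointwise i j
      rewrite mem-∪ i S B | mem-∪ j S B | mem-∪ i X (B ∪ S) | mem-∪ j X (B ∪ S) | mem-∪ i B S | mem-∪ j B S
            | mem-∪ i (S ∪ X) B | mem-∪ j (S ∪ X) B | mem-∪ i S X | mem-∪ j S X
      = ⇒ᵇ-elim (⇒ᵇ-elim (truthTable-sound 6 tautology _
                            (mem i S) (mem j S) (mem i X) (mem j X) (mem i B) (mem j B)) (hyp i)) (hyp j)

  maximal⇒edgeWeight≤ : ∀ {B S X : Subset n} → Maximal B S → Disjoint X B →
                        edgeWeight X (X ∪ B) ≤ hatρ G B S * size X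
  maximal⇒edgeWeight≤ {B} {S} {X} max X#B with nonempty? X
  ... | yes ne = divN≤⇒≤*size ne (max X (ne , X#B))
  ... | no ¬ne rewrite Empty-unique ¬ne = ≤-reflexive (trans (edgeWeight-⊥ (⊥ ∪ B))
          (sym (trans (cong (hatρ G B S *_) (size-⊥ {n})) (*-zeroʳ (hatρ G B S)))))

  hatρ-antitone : ∀ {B S X : Subset n} → Adm B S → Maximal B S → Adm (B ∪ S) X →
                  hatρ G (B ∪ S) X ≤ hatρ G B S
  hatρ-antitone {B} {S} {X} (neS , S#B) max (neX , X#BS) = ≤*size⇒divN≤ neX (+-cancelˡ-≤ (ρ * size S) (begin
    ρ * size S + edgeWeight X (X ∪ (B ∪ S))            ≡⟨ cong (_+ edgeWeight X (X ∪ (B ∪ S))) (divN-size neS (edgeWeight S (S ∪ B))) ⟩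
    edgeWeight S (S ∪ B) + edgeWeight X (X ∪ (B ∪ S))  ≡⟨ edgeWeight-∪ S#B X#BS ⟨
    edgeWeight (S ∪ X) ((S ∪ X) ∪ B)                   ≤⟨ maximal⇒edgeWeight≤ {B} {S} max SX#B ⟩
    ρ * size (S ∪ X)                                   ≡⟨ cong (ρ *_) (size-∪ (Disjoint-sym X#S)) ⟩
    ρ * (size S + size X)                              ≡⟨ *-distribˡ-+ ρ (size S) (size X) ⟩
    ρ * size S + ρ * size X                            ∎))
    where
    open ≤-Reasoning
    ρ = hatρ G B S
    X#S : Disjoint X S
    X#S = proj₂ (Disjoint-∪⁻ X#BS)
    SX#B : Disjoint (S ∪ X) B
    SX#B i i∈SX i∈B with x∈p∪q⁻ S X i∈SX
    ... | inj₁ i∈S = S#B i i∈S i∈B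
    ... | inj₂ i∈X = proj₁ (Disjoint-∪⁻ X#BS) i i∈X i∈B

  size-peel : ∀ {S Z : Subset n} → Z ⊆ S → size S ≡ size Z + size (S ∩ ∁ Z)
  size-peel {S} {Z} Z⊆S = size-partitions Z (S ∩ ∁ Z) S pointwise
    where
    tautology : BoolFun 2
    tautology s z = (z ⇒ᵇ s) ⇒ᵇ partitions z (s ∧ not z) s
    pointwise : ∀ i → T (partitions (mem i Z) (mem i (S ∩ ∁ Z)) (mem i S))
    pointwise i rewrite mem-∩ i S (∁ Z) | mem-∁ i Z =
      ⇒ᵇ-elim (truthTable-sound 2 tautology _ (mem i S) (mem i Z)) (⊆⇒ᵇ Z⊆S i)

  edgeWeight-peel : ∀ {B S Z : Subset n} → Disjoint S B → Z ⊆ S →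
                    edgeWeight S (S ∪ B) ≡ edgeWeight Z (S ∪ B) + edgeWeight (S ∩ ∁ Z) ((S ∩ ∁ Z) ∪ B)
  edgeWeight-peel {B} {S} {Z} S#B Z⊆S = pairSum-partitions G pointwise
    where
    hyp : ∀ i → T (not (mem i S ∧ mem i B) ∧ (mem i Z ⇒ᵇ mem i S))
    hyp i = ∧-intro (disjoint⇒ᵇ S#B i) (⊆⇒ᵇ Z⊆S i)
    tautology : BoolFun 6
    tautology s s′ z z′ b b′ = (not (s ∧ b) ∧ (z ⇒ᵇ s)) ⇒ᵇ (not (s′ ∧ b′) ∧ (z′ ⇒ᵇ s′)) ⇒ᵇ
      partitions (incidentᵇ z z′ (s ∨ b) (s′ ∨ b′))
                 (incidentᵇ (s ∧ not z) (s′ ∧ not z′) ((s ∧ not z) ∨ b) ((s′ ∧ not z′) ∨ b′))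
                 (incidentᵇ s s′ (s ∨ b) (s′ ∨ b′))
    pointwise : ∀ i j → T (partitions (incident Z (S ∪ B) i j) (incident (S ∩ ∁ Z) ((S ∩ ∁ Z) ∪ B) i j)
                                      (incident S (S ∪ B) i j))
    pointwise i j
      rewrite mem-∪ i S B | mem-∪ j S B | mem-∪ i (S ∩ ∁ Z) B | mem-∪ j (S ∩ ∁ Z) B
            | mem-∩ i S (∁ Z) | mem-∩ j S (∁ Z) | mem-∁ i Z | mem-∁ j Z
      = ⇒ᵇ-elim (⇒ᵇ-elim (truthTable-sound 6 tautology _
                            (mem i S) (mem j S) (mem i Z) (mem j Z) (mem i B) (mem j B)) (hyp i)) (hyp j)

  -- S ∩ ∁ Z is a candidate for the maximisation, so Z must carry at least its share of the weight of S.
  maximal-peel : ∀ {B S Z : Subset n} → Adm B S → Maximal B S → Z ⊆ S →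
                 hatρ G B S * size Z ≤ edgeWeight Z (S ∪ B)
  maximal-peel {B} {S} {Z} (neS , S#B) max Z⊆S = +-cancelʳ-≤ (ρ * size W) (begin
    ρ * size Z + ρ * size W                  ≡⟨ *-distribˡ-+ ρ (size Z) (size W) ⟨
    ρ * (size Z + size W)                    ≡⟨ cong (ρ *_) (size-peel Z⊆S) ⟨
    ρ * size S                               ≡⟨ divN-size neS (edgeWeight S (S ∪ B)) ⟩
    edgeWeight S (S ∪ B)                     ≡⟨ edgeWeight-peel S#B Z⊆S ⟩
    edgeWeight Z (S ∪ B) + edgeWeight W (W ∪ B)  ≤⟨ +-monoʳ-≤ (edgeWeight Z (S ∪ B)) (maximal⇒edgeWeight≤ {B} {S} max W#B) ⟩
    edgeWeight Z (S ∪ B) + ρ * size W        ∎)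
    where
    open ≤-Reasoning
    ρ = hatρ G B S
    W = S ∩ ∁ Z
    W#B : Disjoint W B
    W#B i i∈W = S#B i (p∩q⊆p S (∁ Z) i∈W)

  size-∩ : ∀ {Y B S : Subset n} → Disjoint B S → Y ⊆ B ∪ S → size Y ≡ size (Y ∩ B) + size (Y ∩ S)
  size-∩ {Y} {B} {S} B#S Y⊆BS = size-partitions (Y ∩ B) (Y ∩ S) Y pointwise
    where
    tautology : BoolFun 3
    tautology y b s = not (b ∧ s) ∧ (y ⇒ᵇ b ∨ s) ⇒ᵇ partitions (y ∧ b) (y ∧ s) y
    pointwise : ∀ i → T (partitions (mem i (Y ∩ B)) (mem i (Y ∩ S)) (mem i Y))
    pointwise i with ⊆⇒ᵇ Y⊆BS i
    ... | Y⇒BS rewrite mem-∩ i Y B | mem-∩ i Y S | mem-∪ i B S =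
      ⇒ᵇ-elim (truthTable-sound 3 tautology _ (mem i Y) (mem i B) (mem i S)) (∧-intro (disjoint⇒ᵇ B#S i) Y⇒BS)

  edgeWeight-∩≤ : ∀ {Y B S : Subset n} → Disjoint B S → Y ⊆ B ∪ S →
                 edgeWeight (Y ∩ B) B + edgeWeight (Y ∩ S) (S ∪ B) ≤ edgeWeight Y (B ∪ S)
  edgeWeight-∩≤ {Y} {B} {S} B#S Y⊆BS = pairSum-packs G pointwise
    where
    hyp : ∀ i → T (not (mem i B ∧ mem i S) ∧ (mem i Y ⇒ᵇ mem i B ∨ mem i S))
    hyp i = ∧-intro (disjoint⇒ᵇ B#S i) (subst (λ b → T (mem i Y ⇒ᵇ b)) (mem-∪ i B S) (⊆⇒ᵇ Y⊆BS i))
    tautology : BoolFun 6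
    tautology y y′ b b′ s s′ = (not (b ∧ s) ∧ (y ⇒ᵇ b ∨ s)) ⇒ᵇ (not (b′ ∧ s′) ∧ (y′ ⇒ᵇ b′ ∨ s′)) ⇒ᵇ
      packs (incidentᵇ (y ∧ b) (y′ ∧ b′) b b′)
            (incidentᵇ (y ∧ s) (y′ ∧ s′) (s ∨ b) (s′ ∨ b′))
            (incidentᵇ y y′ (b ∨ s) (b′ ∨ s′))
    pointwise : ∀ i j → T (packs (incident (Y ∩ B) B i j) (incident (Y ∩ S) (S ∪ B) i j) (incident Y (B ∪ S) i j))
    pointwise i j
      rewrite mem-∩ i Y B | mem-∩ j Y B | mem-∩ i Y S | mem-∩ j Y S
            | mem-∪ i S B | mem-∪ j S B | mem-∪ i B S | mem-∪ j B S
      = ⇒ᵇ-elim (⇒ᵇ-elim (truthTable-sound 6 tautology _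
                            (mem i Y) (mem j Y) (mem i B) (mem j B) (mem i S) (mem j S)) (hyp i)) (hyp j)

  expanding-⊥ : ∀ ρ → Expanding ρ ⊥
  expanding-⊥ ρ Y Y⊆⊥ rewrite Empty-unique (λ (_ , i∈Y) → ∉⊥ (Y⊆⊥ i∈Y)) =
    ≤-trans (≤-reflexive (trans (cong (ρ *_) (size-⊥ {n})) (*-zeroʳ ρ))) (0≤pairSum G (incident ⊥ ⊥))

  expanding-∪ : ∀ {ρ} {B S : Subset n} → Adm B S → Maximal B S → ρ ≤ hatρ G B S →
                Expanding ρ B → Expanding ρ (B ∪ S)
  expanding-∪ {ρ} {B} {S} admS@(_ , S#B) max ρ≤ expB Y Y⊆BS = begin
    ρ * size Y                                           ≡⟨ cong (ρ *_) (size-∩ B#S Y⊆BS) ⟩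
    ρ * (size (Y ∩ B) + size (Y ∩ S))                    ≡⟨ *-distribˡ-+ ρ (size (Y ∩ B)) (size (Y ∩ S)) ⟩
    ρ * size (Y ∩ B) + ρ * size (Y ∩ S)                  ≤⟨ +-mono-≤ (expB (Y ∩ B) (p∩q⊆q Y B)) inS ⟩
    edgeWeight (Y ∩ B) B + edgeWeight (Y ∩ S) (S ∪ B)   ≤⟨ edgeWeight-∩≤ B#S Y⊆BS ⟩
    edgeWeight Y (B ∪ S)                                 ∎
    where
    open ≤-Reasoning
    B#S : Disjoint B S
    B#S = Disjoint-sym S#B
    inS : ρ * size (Y ∩ S) ≤ edgeWeight (Y ∩ S) (S ∪ B)
    inS = ≤-trans (*-monoʳ-≤-0≤ (0≤fromℕ ∣ Y ∩ S ∣) ρ≤) (maximal-peel admS max (p∩q⊆q Y S))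

  ρ*≤hatρ-first : ∀ {B S Ss v r} → Decomp G B (S ∷ Ss) → RhoStar G B (S ∷ Ss) v r → r ≤ hatρ G B S
  ρ*≤hatρ-first _ (here _) = ≤-refl
  ρ*≤hatρ-first (step _ _ _ (done _)) (there ())
  ρ*≤hatρ-first (step admS max _ D@(step admS′ _ _ _)) (there ρ*) =
    ≤-trans (ρ*≤hatρ-first D ρ*) (hatρ-antitone admS max admS′)

  expanding-prefix : ∀ {B Ss v r} → Decomp G B Ss → RhoStar G B Ss v r → Expanding r B →
                   ∃ λ C → v ∈ C × Expanding r C
  expanding-prefix (step admS max _ _) (here v∈S) expB =
    _ , x∈p∪q⁺ (inj₂ v∈S) , expanding-∪ admS max ≤-refl expB
  expanding-prefix D@(step admS max _ D′) (there ρ*) expB =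
    expanding-prefix D′ ρ* (expanding-∪ admS max (ρ*≤hatρ-first D (there ρ*)) expB)

-- Hop layers around v

inducedEdges : ∀ {n} → WGraph n → Subset n → Fin n → Fin n → Bool
inducedEdges G U i j = mem i U ∧ mem j U ∧ isYes (0ℚ ℚ.<? w G i j)

induced : ∀ {n} (G : WGraph n) (U : Subset n) → Nonempty U → Subgraph G
induced G U ne = record { U = U ; U≠∅ = ne ; F = inducedEdges G U ; F-ok = edges-ok }
  where
  edges-ok : ∀ i j → inducedEdges G U i j ≡ true → (i ∈ U) × (j ∈ U) × IsEdge G i j
  edges-ok i j eq with ∧-elim (Equivalence.from T-≡ eq)
  ... | i∈U , rest with ∧-elim rest
  ... | j∈U , edge = T⇒∈ i∈U , T⇒∈ j∈U , toWitness edge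

module Layers {n} (G : WGraph n) (v : Fin n) where

  within? : ∀ t u → Dec (Within G v t u)
  within? zero u with u ≟ v
  ... | yes refl = yes here
  ... | no u≢v   = no λ { here → u≢v refl }
  within? (suc t) u with u ≟ v | any? (λ u′ → within? t u′ ×-dec (0ℚ ℚ.<? w G u′ u))
  ... | yes refl | _                  = yes here
  ... | no _     | yes (_ , p , edge) = yes (step p edge)
  ... | no u≢v   | no ¬step           = no λ { here → u≢v refl ; (step p edge) → ¬step (_ , p , edge) }

  within-mono : ∀ {s t u} → s ℕ.≤ t → Within G v s u → Within G v t u
  within-mono _         here         = here
  within-mono (s≤s s≤t) (step p edge) = step (within-mono s≤t p) edge

  module _ (C : Subset n) where

    layer : ℕ → Subset n
    layer j = tabulate (λ u → isYes (within? j u) ∧ mem u C)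

    layer⁻ : ∀ {j u} → u ∈ layer j → Within G v j u × u ∈ C
    layer⁻ {j} {u} u∈L with ∧-elim (subst T (lookup∘tabulate _ u) (∈⇒T u∈L))
    ... | within , u∈C = toWitness within , T⇒∈ u∈C

    layer⁺ : ∀ {j u} → Within G v j u → u ∈ C → u ∈ layer j
    layer⁺ {j} {u} within u∈C =
      T⇒∈ (subst T (sym (lookup∘tabulate _ u)) (∧-intro (fromWitness within) (∈⇒T u∈C)))

    next-layer : ∀ {j i k} → i ∈ layer j → k ∈ C → IsEdge G i k → i ∈ layer (suc j) × k ∈ layer (suc j)
    next-layer {j} i∈L k∈C edge with layer⁻ i∈L
    ... | within , i∈C = layer⁺ (within-mono (ℕₚ.n≤1+n j) within) i∈C , layer⁺ (step within edge) k∈C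

    open LocalDensity G using (edgeWeight; incident)

    edgeWeight-layer≤ : ∀ j → edgeWeight (layer j) C ≤ pairSum G (inducedEdges G (layer (suc j)))
    edgeWeight-layer≤ j = pairSum-mono-edges G pointwise
      where
      pointwise : ∀ i k → T (incident (layer j) C i k) → IsEdge G i k → T (inducedEdges G (layer (suc j)) i k)
      pointwise i k h edge with Equivalence.to T-∨ h
      ... | inj₁ ik with ∧-elim ik
      ...   | i∈L , k∈C with next-layer (T⇒∈ i∈L) (T⇒∈ k∈C) edge
      ...     | i∈L′ , k∈L′ = ∧-intro (∈⇒T i∈L′) (∧-intro (∈⇒T k∈L′) (fromWitness edge))
      pointwise i k h edge | inj₂ ki with ∧-elim ki
      ...   | k∈L , i∈C with next-layer (T⇒∈ k∈L) (T⇒∈ i∈C) (subst (0ℚ <_) (WGraph.sym G i k) edge)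
      ...     | k∈L′ , i∈L′ = ∧-intro (∈⇒T i∈L′) (∧-intro (∈⇒T k∈L′) (fromWitness edge))

module DenseLayer {n} (G : WGraph n) (v : Fin n) {C : Subset n} (v∈C : v ∈ C)
                  {r : ℚ} (expanding : LocalDensity.Expanding G r C) (q : ℚ) (0≤q : 0ℚ ≤ q) where

  open Layers G v

  Y : ℕ → Subset n
  Y = layer C

  v∈Y : ∀ j → v ∈ Y j
  v∈Y j = layer⁺ C here v∈C

  H : ℕ → Subgraph G
  H j = induced G (Y j) (v , v∈Y j)

  H-inBall : ∀ {j t} → j ℕ.≤ t → InBall G t v (H j)
  H-inBall j≤t u u∈Y = within-mono j≤t (proj₁ (layer⁻ C u∈Y))

  r*size≤weight : ∀ j → r * size (Y j) ≤ pairSum G (inducedEdges G (Y (suc j)))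
  r*size≤weight j = ≤-trans (expanding (Y j) (λ u∈Y → proj₂ (layer⁻ C u∈Y))) (edgeWeight-layer≤ C j)

  Dense : ℕ → Set
  Dense t = Σ (Subgraph G) (λ H → InBall G t v H × (q * r ≤ density H))

  sparse⇒grows : 0ℚ < r → ∀ j → ¬ (q * r ≤ density (H (suc j))) → size (Y j) < q * size (Y (suc j))
  sparse⇒grows 0<r j sparse = *-cancelˡ-<-nonNeg r {{nonNegative (<⇒≤ 0<r)}} (begin-strict
    r * size (Y j)                            ≤⟨ r*size≤weight j ⟩
    pairSum G (inducedEdges G (Y (suc j)))    <⟨ ≰⇒> (sparse ∘ *size≤⇒≤divN {X = Y (suc j)} (v , v∈Y (suc j))) ⟩
    q * r * size (Y (suc j))                  ≡⟨ swap q r (size (Y (suc j))) ⟩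
    r * (q * size (Y (suc j)))                ∎)
    where
    open ≤-Reasoning
    swap : ∀ a b c → a * b * c ≡ b * (a * c)
    swap = solve-∀ ℚ-ring

  dense⊎grows : 0ℚ < r → ∀ {t} j → suc j ℕ.≤ t → Dense t ⊎ size (Y j) < q * size (Y (suc j))
  dense⊎grows 0<r j j<t = Sum.map (λ dense → H (suc j) , H-inBall j<t , dense) (sparse⇒grows 0<r j)
                                    (toSum (q * r ℚ.≤? density (H (suc j))))

  dense⊎grows-geometrically : 0ℚ < r → ∀ {t} j → suc j ℕ.≤ t → Dense t ⊎ size (Y 0) < q ^ suc j * size (Y (suc j))
  dense⊎grows-geometrically 0<r zero j<t =
    Sum.map₂ (subst (λ p → size (Y 0) < p * size (Y 1)) (sym (*-identityʳ q))) (dense⊎grows 0<r zero j<t)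
  dense⊎grows-geometrically 0<r (suc j) j<t =
    Sum.[ inj₁ , (λ chain → Sum.map₂ (extend chain) (dense⊎grows 0<r (suc j) j<t)) ]
      (dense⊎grows-geometrically 0<r j (ℕₚ.<⇒≤ j<t))
    where
    open ≤-Reasoning
    swap : ∀ a b c → a * (b * c) ≡ b * a * c
    swap = solve-∀ ℚ-ring
    extend : size (Y 0) < q ^ suc j * size (Y (suc j)) → size (Y (suc j)) < q * size (Y (suc (suc j))) →
             size (Y 0) < q ^ suc (suc j) * size (Y (suc (suc j)))
    extend chain grow = begin-strict
      size (Y 0)                                 <⟨ chain ⟩
      q ^ suc j * size (Y (suc j))               ≤⟨ *-monoˡ-≤-0≤ (0≤^ (suc j) 0≤q) (<⇒≤ grow) ⟩
      q ^ suc j * (q * size (Y (suc (suc j))))   ≡⟨ swap (q ^ suc j) q (size (Y (suc (suc j)))) ⟩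
      q ^ suc (suc j) * size (Y (suc (suc j)))   ∎

  r≤0⇒dense : r ≤ 0ℚ → ∀ t → Dense t
  r≤0⇒dense r≤0 t = H 0 , H-inBall z≤n , ≤-trans (≤-trans (*-monoˡ-≤-0≤ 0≤q r≤0) (≤-reflexive (*-zeroʳ q)))
                                               (0≤divN (0≤pairSum G (inducedEdges G (Y 0))) ∣ Y 0 ∣)

  n≤1⇒r≤0 : n ℕ.≤ 1 → r ≤ 0ℚ
  n≤1⇒r≤0 n≤1 = *-cancelʳ-≤-pos (size (Y 0)) {{positive (0<size (v , v∈Y 0))}} (begin
    r * size (Y 0)                             ≤⟨ r*size≤weight 0 ⟩
    pairSum G (inducedEdges G (Y 1))           ≡⟨ pairSum-trivial G (inducedEdges G (Y 1)) n≤1 ⟩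
    0ℚ                                         ≡⟨ *-zeroˡ (size (Y 0)) ⟨
    0ℚ * size (Y 0)                            ∎)
    where open ≤-Reasoning

  dense-layer : ∀ t → q ^ t * fromℕ n ≤ 1ℚ → Dense t
  dense-layer zero bound =
    r≤0⇒dense (n≤1⇒r≤0 (fromℕ-cancel-≤ (subst (_≤ 1ℚ) (*-identityˡ (fromℕ n)) bound))) zero
  dense-layer (suc t) bound = by-sign (r ℚ.≤? 0ℚ)
    where
    open ≤-Reasoning
    all-sparse-impossible : ¬ (size (Y 0) < q ^ suc t * size (Y (suc t)))
    all-sparse-impossible sparse = <-irrefl refl (begin-strict
      1ℚ                                         ≤⟨ 1≤size (v , v∈Y 0) ⟩
      size (Y 0)                                 <⟨ sparse ⟩
      q ^ suc t * size (Y (suc t))               ≤⟨ *-monoˡ-≤-0≤ (0≤^ (suc t) 0≤q) (size≤n (Y (suc t))) ⟩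
      q ^ suc t * fromℕ n                        ≤⟨ bound ⟩
      1ℚ                                         ∎)
    by-sign : Dec (r ≤ 0ℚ) → Dense (suc t)
    by-sign (yes r≤0) = r≤0⇒dense r≤0 (suc t)
    by-sign (no r≰0)  = Sum.fromInj₁ (λ sparse → contradiction sparse all-sparse-impossible)
                          (dense⊎grows-geometrically (≰⇒> r≰0) t ℕₚ.≤-refl)

lemma40 : (ε : ℚ) → 0ℚ < ε → ε ≤ 1ℚ → (n t : ℕ) → IsCeilLog ε n t →
          (G : WGraph n) (v : Fin n) (Ss : List (Subset n)) → Decomp G ⊥ Ss →
          (r : ℚ) → RhoStar G ⊥ Ss v r →
          Σ (Subgraph G) (λ H → InBall G t v H × ((1ℚ - ε) * r ≤ density H))
lemma40 ε 0<ε ε≤1 n t (logBound , _) G v Ss decomp r ρ* =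
  let (_ , v∈C , expanding) = LocalDensity.expanding-prefix G decomp ρ* (LocalDensity.expanding-⊥ G r)
  in DenseLayer.dense-layer G v v∈C expanding (1ℚ - ε) (p≤q⇒0≤q-p ε≤1) t (logBound⇒[1-ε]^t*n≤1 {n = n} {t} (<⇒≤ 0<ε) ε≤1 logBound)
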